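{- Let $\#$ be a parametrized monad on a category $\mathbf{C}$ with finite coproducts such that for every object $X$ a final coalgebra $\mathsf{out}_X:\Phi X\to X\#\Phi X$ of $X\#(-)$ exists. Then the category $\mathbf{C}^{\Phi}$ of Eilenberg–Moore algebras of the monad $\Phi$ and the category $\mathbf{CElg}_\#(\mathbf{C})$ of complete Elgot $\#$-algebras are isomorphic, via mutually inverse functors that are the identity on underlying morphisms and act on objects as follows: (a) a $\Phi$-algebra $(A,\chi:\Phi A\to A)$ is sent to the complete Elgot $\#$-algebra $(A,\ \chi\circ\mathsf{out}_A^{ -1}\circ(\mathrm{id}_A\#\eta^\nu_A),\ (-)^\dagger)$ with $e^\dagger=\chi\circ\mathrm{coit}\,e$ for every $e:X\to A\#X$; (b) a complete Elgot $\#$-algebra $(A,a,(-)^\dagger)$ is sent to the $\Phi$-algebra $(A,\ \mathsf{out}_A^\dagger:\Phi A\to A)$.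
   Context: A parametrized monad is a bifunctor $\#:\mathbf{C}\times\mathbf{C}\to\mathbf{C}$ such that each $(-)\#X$ is a monad with unit $u^X_A:A\to A\#X$ and multiplication $m^X_A:(A\#X)\#X\to A\#X$, and for each $f:X\to Y$ the family $(\mathrm{id}_Z\#f)_Z$ is a monad morphism. $\mathrm{coit}\,e:X\to\Phi A$ is the unique coalgebra morphism from $(X,e:X\to A\#X)$ to $(\Phi A,\mathsf{out}_A)$. $\Phi$ is a monad with unit $\eta^\nu_X=\mathsf{out}_X^{ -1}\circ u^{\Phi X}_X$ and Kleisli lifting: for $h:X\to\Phi Y$, $h^*$ is the unique morphism with $\mathsf{out}_Y\circ h^*=m^{\Phi Y}_Y\circ((\mathsf{out}_Y\circ h)\#h^*)\circ\mathsf{out}_X$; $\mu^\nu=\mathrm{id}^*$, $\Phi g=(\eta^\nu\circ g)^*$. A $\Phi$-algebra is $\chi:\Phi A\to A$ with $\chi\circ\eta^\nu_A=\mathrm{id}$, $\chi\circ\Phi\chi=\chi\circ\mu^\nu_A$. A $\#$-algebra is $(A,a)$ with $a:A\#A\to A$, $a\circ u^A_A=\mathrm{id}$, $a\circ(a\#\mathrm{id})=a\circ m^A_A$. A complete Elgot $\#$-algebra is a $\#$-algebra $(A,a)$ with an operator sending each $e:X\to A\#X$ to $e^\dagger:X\to A$ such that: (solution) $e^\dagger=a\circ(\mathrm{id}_A\#e^\dagger)\circ e$; (functoriality) for $e:X\to A\#X$, $f:Y\to A\#Y$, $h:X\to Y$, if $f\circ h=(\mathrm{id}_A\#h)\circ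 e$ then $f^\dagger\circ h=e^\dagger$; (compositionality) for $f:Y\to A\#Y$, $g:X\to Y\#X$, with $f^\dagger\bullet g=(f^\dagger\#\mathrm{id}_X)\circ g$ and $f\blacksquare g=m^{Y+X}_A\circ(((\mathrm{id}_A\#\mathsf{inl})\circ f)\#\mathsf{inr})\circ[u^X_Y,g]$, one has $(f\blacksquare g)^\dagger\circ\mathsf{inr}=(f^\dagger\bullet g)^\dagger$. Morphisms $(A,a,\dagger)\to(B,b,\ddagger)$ in $\mathbf{CElg}_\#(\mathbf{C})$ are $f:A\to B$ with $((f\#\mathrm{id}_X)\circ e)^\ddagger=f\circ e^\dagger$ for all $e:X\to A\#X$. -}

module Defs where

open import Level using (Level; _⊔_) renaming (suc to lsuc)
open import Relation.Binary using (Rel; IsEquivalence)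
open import Data.Product using (_×_)

record Category (o ℓ e : Level) : Set (lsuc (o ⊔ ℓ ⊔ e)) where
  infixr 9 _∘_
  infix  4 _≈_
  infix  4 _⇒_
  field
    Obj : Set o
    _⇒_ : Obj → Obj → Set ℓ
    _≈_ : ∀ {A B} → Rel (A ⇒ B) e
    id  : ∀ {A} → A ⇒ A
    _∘_ : ∀ {A B C} → B ⇒ C → A ⇒ B → A ⇒ C
    ≈-equiv   : ∀ {A B} → IsEquivalence (_≈_ {A} {B})
    ∘-resp-≈  : ∀ {A B C} {f h : B ⇒ C} {g i : A ⇒ B} →
                f ≈ h → g ≈ i → f ∘ g ≈ h ∘ i
    identityˡ : ∀ {A B} {f : A ⇒ B} → id ∘ f ≈ f
    identityʳ : ∀ {A B} {f : A ⇒ B} → f ∘ id ≈ f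
    assoc     : ∀ {A B C D} {f : A ⇒ B} {g : B ⇒ C} {h : C ⇒ D} →
                (h ∘ g) ∘ f ≈ h ∘ (g ∘ f)

record FiniteCoproducts {o ℓ e} (C : Category o ℓ e) : Set (o ⊔ ℓ ⊔ e) where
  open Category C
  infixr 6 _+_
  field
    ⊥      : Obj
    ¡      : ∀ {A} → ⊥ ⇒ A
    ¡-unique : ∀ {A} (f : ⊥ ⇒ A) → ¡ ≈ f
    _+_    : Obj → Obj → Obj
    inl    : ∀ {A B} → A ⇒ A + B
    inr    : ∀ {A B} → B ⇒ A + B
    [_,_]  : ∀ {A B D} → A ⇒ D → B ⇒ D → A + B ⇒ D
    inject₁ : ∀ {A B D} {f : A ⇒ D} {g : B ⇒ D} → [ f , g ] ∘ inl ≈ f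
    inject₂ : ∀ {A B D} {f : A ⇒ D} {g : B ⇒ D} → [ f , g ] ∘ inr ≈ g
    +-unique : ∀ {A B D} {f : A ⇒ D} {g : B ⇒ D} {h : A + B ⇒ D} →
               h ∘ inl ≈ f → h ∘ inr ≈ g → [ f , g ] ≈ h

-- Parametrized monads  # : C × C → C
-- u {X} {A} = u^X_A : A → A # X ,  m {X} {A} = m^X_A : (A # X) # X → A # X

record ParametrizedMonad {o ℓ e} (C : Category o ℓ e) : Set (o ⊔ ℓ ⊔ e) where
  open Category C
  infixl 7 _#_ _#₁_
  field
    _#_  : Obj → Obj → Obj
    _#₁_ : ∀ {A B X Y} → A ⇒ B → X ⇒ Y → A # X ⇒ B # Y
    #-identity : ∀ {A X} → id {A} #₁ id {X} ≈ id
    #-homomorphism : ∀ {A B D X Y Z} {f : B ⇒ D} {g : A ⇒ B} {h : Y ⇒ Z} {k : X ⇒ Y} →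
                     (f ∘ g) #₁ (h ∘ k) ≈ (f #₁ h) ∘ (g #₁ k)
    #-resp-≈ : ∀ {A B X Y} {f f′ : A ⇒ B} {g g′ : X ⇒ Y} →
               f ≈ f′ → g ≈ g′ → f #₁ g ≈ f′ #₁ g′
    u : ∀ {X A} → A ⇒ A # X
    m : ∀ {X A} → (A # X) # X ⇒ A # X
    u-natural : ∀ {X A B} (f : A ⇒ B) → (f #₁ id {X}) ∘ u {X} {A} ≈ u {X} {B} ∘ f
    m-natural : ∀ {X A B} (f : A ⇒ B) →
                (f #₁ id {X}) ∘ m {X} {A} ≈ m {X} {B} ∘ ((f #₁ id {X}) #₁ id {X})
    m-assoc : ∀ {X A} → m {X} {A} ∘ (m {X} {A} #₁ id {X}) ≈ m {X} {A} ∘ m {X} {A # X}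
    m-identityˡ : ∀ {X A} → m {X} {A} ∘ (u {X} {A} #₁ id {X}) ≈ id
    m-identityʳ : ∀ {X A} → m {X} {A} ∘ u {X} {A # X} ≈ id
    u-morphism : ∀ {X Y Z} (f : X ⇒ Y) → (id {Z} #₁ f) ∘ u {X} {Z} ≈ u {Y} {Z}
    m-morphism : ∀ {X Y Z} (f : X ⇒ Y) →
                 (id {Z} #₁ f) ∘ m {X} {Z}
                   ≈ m {Y} {Z} ∘ (((id {Z} #₁ f) #₁ id {Y}) ∘ (id {Z # X} #₁ f))

record FinalCoalgebras {o ℓ e} {C : Category o ℓ e} (P : ParametrizedMonad C)
       : Set (o ⊔ ℓ ⊔ e) where
  open Category C
  open ParametrizedMonad P
  field
    Φ    : Obj → Obj
    out  : ∀ {A} → Φ A ⇒ A # Φ A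
    coit : ∀ {A X} → X ⇒ A # X → X ⇒ Φ A
    coit-commute : ∀ {A X} (e : X ⇒ A # X) → out ∘ coit e ≈ (id #₁ coit e) ∘ e
    coit-unique  : ∀ {A X} (e : X ⇒ A # X) (h : X ⇒ Φ A) →
                   out ∘ h ≈ (id #₁ h) ∘ e → h ≈ coit e

  -- the inverse of out (Lambek's lemma): coit (id # out)
  out⁻¹ : ∀ {A} → A # Φ A ⇒ Φ A
  out⁻¹ {A} = coit (id {A} #₁ out {A})

  η : ∀ {X} → X ⇒ Φ X
  η {X} = out⁻¹ ∘ u {Φ X} {X}

record KleisliLifting {o ℓ e} {C : Category o ℓ e} {P : ParametrizedMonad C}
       (F : FinalCoalgebras P) : Set (o ⊔ ℓ ⊔ e) where
  open Category C
  open ParametrizedMonad P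
  open FinalCoalgebras F
  infix 10 _*
  field
    _* : ∀ {X Y} → X ⇒ Φ Y → Φ X ⇒ Φ Y
    *-commute : ∀ {X Y} (h : X ⇒ Φ Y) →
                out ∘ (h *) ≈ m {Φ Y} {Y} ∘ (((out ∘ h) #₁ (h *)) ∘ out)
    *-unique  : ∀ {X Y} (h : X ⇒ Φ Y) (k : Φ X ⇒ Φ Y) →
                out ∘ k ≈ m {Φ Y} {Y} ∘ (((out ∘ h) #₁ k) ∘ out) → k ≈ h *

  μ : ∀ {X} → Φ (Φ X) ⇒ Φ X
  μ = id *

  Φ₁ : ∀ {X Y} → X ⇒ Y → Φ X ⇒ Φ Y
  Φ₁ g = (η ∘ g) *

module Notions {o ℓ e} (C : Category o ℓ e) (cop : FiniteCoproducts C)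
               (P : ParametrizedMonad C) (F : FinalCoalgebras P)
               (K : KleisliLifting F) where
  open Category C
  open FiniteCoproducts cop
  open ParametrizedMonad P
  open FinalCoalgebras F
  open KleisliLifting K

  IsΦAlgebra : (A : Obj) → Φ A ⇒ A → Set e
  IsΦAlgebra A χ = (χ ∘ η ≈ id) × (χ ∘ Φ₁ χ ≈ χ ∘ μ)

  IsΦAlgebraHom : ∀ {A B} → Φ A ⇒ A → Φ B ⇒ B → A ⇒ B → Set e
  IsΦAlgebraHom χ χ′ f = f ∘ χ ≈ χ′ ∘ Φ₁ f

  DaggerOp : Obj → Set (o ⊔ ℓ)
  DaggerOp A = ∀ {X} → X ⇒ A # X → X ⇒ A

  bullet : ∀ {A Y X} → DaggerOp A → Y ⇒ A # Y → X ⇒ Y # X → X ⇒ A # X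
  bullet † f g = († f #₁ id) ∘ g

  square : ∀ {A Y X} → Y ⇒ A # Y → X ⇒ Y # X → Y + X ⇒ A # (Y + X)
  square {A} {Y} {X} f g =
    m {Y + X} {A} ∘ ((((id {A} #₁ inl) ∘ f) #₁ inr) ∘ [ u {X} {Y} , g ])

  record IsCompleteElgot (A : Obj) (a : A # A ⇒ A) († : DaggerOp A)
         : Set (o ⊔ ℓ ⊔ e) where
    field
      alg-unit : a ∘ u {A} {A} ≈ id
      alg-mult : a ∘ (a #₁ id {A}) ≈ a ∘ m {A} {A}
      solution : ∀ {X} (e : X ⇒ A # X) → † e ≈ a ∘ ((id #₁ † e) ∘ e)
      functoriality : ∀ {X Y} (e : X ⇒ A # X) (f : Y ⇒ A # Y) (h : X ⇒ Y) →
                      f ∘ h ≈ (id #₁ h) ∘ e → † f ∘ h ≈ † e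
      compositionality : ∀ {X Y} (f : Y ⇒ A # Y) (g : X ⇒ Y # X) →
                         † (square f g) ∘ inr ≈ † (bullet † f g)

  IsElgotHom : ∀ {A B} → DaggerOp A → DaggerOp B → A ⇒ B → Set (o ⊔ ℓ ⊔ e)
  IsElgotHom {A} {B} † ‡ f =
    ∀ {X} (e : X ⇒ A # X) → ‡ ((f #₁ id) ∘ e) ≈ f ∘ † e

  algOf : ∀ {A} → Φ A ⇒ A → A # A ⇒ A
  algOf {A} χ = χ ∘ (out⁻¹ ∘ (id {A} #₁ η {A}))

  daggerOf : ∀ {A} → Φ A ⇒ A → DaggerOp A
  daggerOf χ e = χ ∘ coit e

  φalgOf : ∀ {A} → DaggerOp A → Φ A ⇒ A
  φalgOf † = † out

-- Φ A is the final coalgebra of possibly infinite #-trees over A: a Φ-algebra χ evaluates such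
-- trees, a complete Elgot algebra solves every recursive equation e : X → A # X. The two are
-- interdefinable: e† evaluates the tree coit e unfolded from e, and conversely evaluation is the
-- solution out† of the tautological equation out : Φ A → A # Φ A. Under this translation the unit and multiplication laws of χ become
-- the #-algebra laws and compositionality of †: the solution of f ■ g at inr unfolds to the
-- flattening μ of the tree of trees obtained from g by substituting coit f for its leaves.
module Submission where

open import Level using (Level)
open import Data.Product using (_×_; _,_; proj₁; proj₂)
open import Relation.Binary using (Setoid; IsEquivalence)
import Relation.Binary.Reasoning.Setoid as SetoidReasoning
open import Defs

module HomReasoning {o ℓ e} (C : Category o ℓ e) where
  open Category C

  hom-setoid : Obj → Obj → Setoid ℓ e
  hom-setoid A B = record { isEquivalence = ≈-equiv {A} {B} }

  module ≈ {A B : Obj} = IsEquivalence (≈-equiv {A} {B})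
  open module Reasoning {A B : Obj} = SetoidReasoning (hom-setoid A B) public
    using (begin_; step-≈-⟩; step-≈-⟨; _∎)

  ∘-resp-≈ˡ : ∀ {A B D} {f h : B ⇒ D} {g : A ⇒ B} → f ≈ h → f ∘ g ≈ h ∘ g
  ∘-resp-≈ˡ p = ∘-resp-≈ p ≈.refl

  ∘-resp-≈ʳ : ∀ {A B D} {f : B ⇒ D} {g i : A ⇒ B} → g ≈ i → f ∘ g ≈ f ∘ i
  ∘-resp-≈ʳ p = ∘-resp-≈ ≈.refl p

  sym-assoc : ∀ {A B D E} {f : A ⇒ B} {g : B ⇒ D} {h : D ⇒ E} → h ∘ g ∘ f ≈ (h ∘ g) ∘ f
  sym-assoc = ≈.sym assoc

  pullˡ : ∀ {A B D E} {a : D ⇒ E} {b : B ⇒ D} {c : B ⇒ E} {f : A ⇒ B} →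
          a ∘ b ≈ c → a ∘ b ∘ f ≈ c ∘ f
  pullˡ p = ≈.trans sym-assoc (∘-resp-≈ˡ p)

  pullʳ : ∀ {A B D E} {a : D ⇒ E} {b : B ⇒ D} {f : A ⇒ B} {c : A ⇒ D} →
          b ∘ f ≈ c → (a ∘ b) ∘ f ≈ a ∘ c
  pullʳ p = ≈.trans assoc (∘-resp-≈ʳ p)

  pushˡ : ∀ {A B D E} {a : D ⇒ E} {b : B ⇒ D} {c : B ⇒ E} {f : A ⇒ B} →
          c ≈ a ∘ b → c ∘ f ≈ a ∘ b ∘ f
  pushˡ p = ≈.sym (pullˡ (≈.sym p))

  extend : ∀ {A B D D′ E} {a : D ⇒ E} {b : B ⇒ D} {c : D′ ⇒ E} {d : B ⇒ D′} {f : A ⇒ B} →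
           a ∘ b ≈ c ∘ d → a ∘ b ∘ f ≈ c ∘ d ∘ f
  extend p = ≈.trans (pullˡ p) assoc

  elimʳ : ∀ {B D} {f : B ⇒ D} {g : B ⇒ B} → g ≈ id → f ∘ g ≈ f
  elimʳ p = ≈.trans (∘-resp-≈ʳ p) identityʳ

  cancelˡ : ∀ {A B D} {a : B ⇒ D} {b : D ⇒ B} {f : A ⇒ D} → a ∘ b ≈ id → a ∘ b ∘ f ≈ f
  cancelˡ p = ≈.trans (pullˡ p) identityˡ

  cancelʳ : ∀ {B D E} {a : D ⇒ E} {b : B ⇒ D} {c : D ⇒ B} → b ∘ c ≈ id → (a ∘ b) ∘ c ≈ a
  cancelʳ p = ≈.trans (pullʳ p) identityʳ

module ParametrizedMonadProperties {o ℓ e} {C : Category o ℓ e} (P : ParametrizedMonad C) where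
  open Category C
  open HomReasoning C
  open ParametrizedMonad P

  #-splitˡ : ∀ {A B X Y} {f : A ⇒ B} {g : X ⇒ Y} → f #₁ g ≈ (f #₁ id) ∘ (id #₁ g)
  #-splitˡ = ≈.trans (#-resp-≈ (≈.sym identityʳ) (≈.sym identityˡ)) #-homomorphism

  #-splitʳ : ∀ {A B X Y} {f : A ⇒ B} {g : X ⇒ Y} → f #₁ g ≈ (id #₁ g) ∘ (f #₁ id)
  #-splitʳ = ≈.trans (#-resp-≈ (≈.sym identityˡ) (≈.sym identityʳ)) #-homomorphism

  id#-homomorphism : ∀ {A X Y Z} {g : Y ⇒ Z} {h : X ⇒ Y} →
                     id {A} #₁ (g ∘ h) ≈ (id #₁ g) ∘ (id #₁ h)
  id#-homomorphism = ≈.trans (#-resp-≈ (≈.sym identityˡ) ≈.refl) #-homomorphism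

  #-identityˡ : ∀ {A X Z} {f : Z ⇒ A # X} → (id #₁ id) ∘ f ≈ f
  #-identityˡ = ≈.trans (∘-resp-≈ˡ #-identity) identityˡ

  u-natural₂ : ∀ {A B X Y} {f : A ⇒ B} {g : X ⇒ Y} → (f #₁ g) ∘ u ≈ u ∘ f
  u-natural₂ {f = f} {g} = begin
    (f #₁ g) ∘ u               ≈⟨ pushˡ #-splitˡ ⟩
    (f #₁ id) ∘ (id #₁ g) ∘ u  ≈⟨ ∘-resp-≈ʳ (u-morphism g) ⟩
    (f #₁ id) ∘ u              ≈⟨ u-natural f ⟩
    u ∘ f                      ∎

  m-morphism₂ : ∀ {X Y Z} {h : X ⇒ Y} → (id {Z} #₁ h) ∘ m ≈ m ∘ ((id #₁ h) #₁ h)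
  m-morphism₂ {h = h} =
    ≈.trans (m-morphism h) (∘-resp-≈ʳ (≈.trans (≈.sym #-homomorphism) (#-resp-≈ identityʳ identityˡ)))

module FinalCoalgebraProperties {o ℓ e} {C : Category o ℓ e} {P : ParametrizedMonad C}
                                (F : FinalCoalgebras P) where
  open Category C
  open HomReasoning C
  open ParametrizedMonad P
  open ParametrizedMonadProperties P
  open FinalCoalgebras F

  coit-resp-≈ : ∀ {A X} {e₁ e₂ : X ⇒ A # X} → e₁ ≈ e₂ → coit e₁ ≈ coit e₂
  coit-resp-≈ p = coit-unique _ _ (≈.trans (coit-commute _) (∘-resp-≈ʳ p))

  coit-fusion : ∀ {A X Y} {e : X ⇒ A # X} {f : Y ⇒ A # Y} {h : X ⇒ Y} →
                f ∘ h ≈ (id #₁ h) ∘ e → coit f ∘ h ≈ coit e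
  coit-fusion {e = e} {f} {h} p = coit-unique e (coit f ∘ h) (begin
    out ∘ coit f ∘ h                ≈⟨ pullˡ (coit-commute f) ⟩
    ((id #₁ coit f) ∘ f) ∘ h        ≈⟨ pullʳ p ⟩
    (id #₁ coit f) ∘ (id #₁ h) ∘ e  ≈⟨ pullˡ (≈.sym id#-homomorphism) ⟩
    (id #₁ (coit f ∘ h)) ∘ e        ∎)

  coit-out : ∀ {A} → coit (out {A}) ≈ id
  coit-out = ≈.sym (coit-unique out id (≈.trans identityʳ (≈.sym #-identityˡ)))

  out⁻¹∘out : ∀ {A} → out⁻¹ ∘ out {A} ≈ id
  out⁻¹∘out = ≈.trans (coit-fusion {e = out} ≈.refl) coit-out

  out∘out⁻¹ : ∀ {A} → out {A} ∘ out⁻¹ ≈ id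
  out∘out⁻¹ = begin
    out ∘ out⁻¹                  ≈⟨ coit-commute _ ⟩
    (id #₁ out⁻¹) ∘ (id #₁ out)  ≈⟨ id#-homomorphism ⟨
    id #₁ (out⁻¹ ∘ out)          ≈⟨ #-resp-≈ ≈.refl out⁻¹∘out ⟩
    id #₁ id                     ≈⟨ #-identity ⟩
    id                           ∎

  switch-outˡ : ∀ {A Z} {f : Z ⇒ Φ A} {g : Z ⇒ A # Φ A} → out ∘ f ≈ g → f ≈ out⁻¹ ∘ g
  switch-outˡ {f = f} {g} p = begin
    f                ≈⟨ cancelˡ out⁻¹∘out ⟨
    out⁻¹ ∘ out ∘ f  ≈⟨ ∘-resp-≈ʳ p ⟩
    out⁻¹ ∘ g        ∎

  out-injective : ∀ {A Z} {f g : Z ⇒ Φ A} → out ∘ f ≈ out ∘ g → f ≈ g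
  out-injective p = ≈.trans (switch-outˡ p) (cancelˡ out⁻¹∘out)

  out∘η : ∀ {A} → out ∘ η {A} ≈ u
  out∘η = cancelˡ out∘out⁻¹

module KleisliProperties {o ℓ e} {C : Category o ℓ e} {P : ParametrizedMonad C}
                         {F : FinalCoalgebras P} (K : KleisliLifting F) where
  open Category C
  open HomReasoning C
  open ParametrizedMonad P
  open ParametrizedMonadProperties P
  open FinalCoalgebras F
  open FinalCoalgebraProperties F
  open KleisliLifting K

  *-η : ∀ {X Y} (h : X ⇒ Φ Y) → (h *) ∘ η ≈ h
  *-η h = out-injective (begin
    out ∘ h * ∘ η                        ≈⟨ pullˡ (*-commute h) ⟩
    (m ∘ ((out ∘ h) #₁ h *) ∘ out) ∘ η   ≈⟨ pullʳ (pullʳ out∘η) ⟩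
    m ∘ ((out ∘ h) #₁ h *) ∘ u           ≈⟨ ∘-resp-≈ʳ u-natural₂ ⟩
    m ∘ u ∘ out ∘ h                      ≈⟨ cancelˡ m-identityʳ ⟩
    out ∘ h                              ∎)

  Φ₁-η : ∀ {X Y} (f : X ⇒ Y) → Φ₁ f ∘ η ≈ η ∘ f
  Φ₁-η f = *-η (η ∘ f)

  μ-η : ∀ {X} → μ ∘ η {Φ X} ≈ id
  μ-η = *-η id

  out∘Φ₁ : ∀ {X Y} (f : X ⇒ Y) → out ∘ Φ₁ f ≈ (f #₁ Φ₁ f) ∘ out
  out∘Φ₁ f = begin
    out ∘ Φ₁ f                             ≈⟨ *-commute (η ∘ f) ⟩
    m ∘ ((out ∘ η ∘ f) #₁ Φ₁ f) ∘ out      ≈⟨ ∘-resp-≈ʳ (∘-resp-≈ˡ (#-resp-≈ (pullˡ out∘η) (≈.sym identityˡ))) ⟩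
    m ∘ ((u ∘ f) #₁ (id ∘ Φ₁ f)) ∘ out     ≈⟨ ∘-resp-≈ʳ (pushˡ #-homomorphism) ⟩
    m ∘ (u #₁ id) ∘ (f #₁ Φ₁ f) ∘ out      ≈⟨ cancelˡ m-identityˡ ⟩
    (f #₁ Φ₁ f) ∘ out                      ∎

  Φ₁-coalgebra : ∀ {X Y} (f : X ⇒ Y) → out ∘ Φ₁ f ≈ (id #₁ Φ₁ f) ∘ (f #₁ id) ∘ out
  Φ₁-coalgebra f = ≈.trans (out∘Φ₁ f) (pushˡ #-splitʳ)

  Φ₁-out⁻¹ : ∀ {X Y} (f : X ⇒ Y) → Φ₁ f ∘ out⁻¹ ≈ out⁻¹ ∘ (f #₁ Φ₁ f)
  Φ₁-out⁻¹ f = switch-outˡ (≈.trans (pullˡ (out∘Φ₁ f)) (cancelʳ out∘out⁻¹))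

  Φ₁-coit : ∀ {A B X} (f : A ⇒ B) (e : X ⇒ A # X) → Φ₁ f ∘ coit e ≈ coit ((f #₁ id) ∘ e)
  Φ₁-coit f e = ≈.trans (∘-resp-≈ˡ (coit-unique _ _ (Φ₁-coalgebra f))) (coit-fusion (begin
    ((f #₁ id) ∘ out) ∘ coit e              ≈⟨ pullʳ (coit-commute e) ⟩
    (f #₁ id) ∘ (id #₁ coit e) ∘ e          ≈⟨ extend (≈.trans (≈.sym #-splitˡ) #-splitʳ) ⟩
    (id #₁ coit e) ∘ (f #₁ id) ∘ e          ∎))

  out∘μ : ∀ {X} → out ∘ μ {X} ≈ m ∘ (out #₁ μ) ∘ out
  out∘μ = ≈.trans (*-commute id) (∘-resp-≈ʳ (∘-resp-≈ˡ (#-resp-≈ identityʳ ≈.refl)))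

  μ-out⁻¹ : ∀ {X} → μ {X} ∘ out⁻¹ ≈ out⁻¹ ∘ m ∘ (out #₁ μ)
  μ-out⁻¹ = switch-outˡ (≈.trans (pullˡ out∘μ) (pullʳ (cancelʳ out∘out⁻¹)))

  out∘μ∘coit : ∀ {A X Y} (c : Y ⇒ Φ A) (g : X ⇒ Y # X) →
               out ∘ μ ∘ coit ((c #₁ id) ∘ g) ≈ m ∘ ((out ∘ c) #₁ (μ ∘ coit ((c #₁ id) ∘ g))) ∘ g
  out∘μ∘coit {A} {X} c g = begin
    out ∘ μ ∘ k                                   ≈⟨ pullˡ out∘μ ⟩
    (m ∘ (out #₁ μ) ∘ out) ∘ k                    ≈⟨ pullʳ (pullʳ (coit-commute _)) ⟩
    m ∘ (out #₁ μ) ∘ (id #₁ k) ∘ (c #₁ id) ∘ g    ≈⟨ ∘-resp-≈ʳ (pullˡ (≈.sym #-homomorphism)) ⟩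
    m ∘ ((out ∘ id) #₁ (μ ∘ k)) ∘ (c #₁ id) ∘ g   ≈⟨ ∘-resp-≈ʳ (pullˡ (≈.sym #-homomorphism)) ⟩
    m ∘ (((out ∘ id) ∘ c) #₁ ((μ ∘ k) ∘ id)) ∘ g  ≈⟨ ∘-resp-≈ʳ (∘-resp-≈ˡ (#-resp-≈ (∘-resp-≈ˡ identityʳ) identityʳ)) ⟩
    m ∘ ((out ∘ c) #₁ (μ ∘ k)) ∘ g                ∎
    where
    k : X ⇒ Φ (Φ A)
    k = coit ((c #₁ id) ∘ g)

module Correspondence {o ℓ e} (C : Category o ℓ e) (cop : FiniteCoproducts C)
  (P : ParametrizedMonad C) (F : FinalCoalgebras P) (K : KleisliLifting F) where
  open Category C
  open HomReasoning C
  open FiniteCoproducts cop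
  open ParametrizedMonad P
  open ParametrizedMonadProperties P
  open FinalCoalgebras F
  open FinalCoalgebraProperties F
  open KleisliLifting K
  open KleisliProperties K
  open Notions C cop P F K

  coproduct-ext : ∀ {A B D} {p q : A + B ⇒ D} → p ∘ inl ≈ q ∘ inl → p ∘ inr ≈ q ∘ inr → p ≈ q
  coproduct-ext pl pr = ≈.trans (≈.sym (+-unique ≈.refl ≈.refl)) (+-unique (≈.sym pl) (≈.sym pr))

  square-inl : ∀ {A Y X} (f : Y ⇒ A # Y) (g : X ⇒ Y # X) → square f g ∘ inl ≈ (id #₁ inl) ∘ f
  square-inl f g = begin
    (m ∘ (((id #₁ inl) ∘ f) #₁ inr) ∘ [ u , g ]) ∘ inl  ≈⟨ pullʳ (pullʳ inject₁) ⟩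
    m ∘ (((id #₁ inl) ∘ f) #₁ inr) ∘ u                  ≈⟨ ∘-resp-≈ʳ u-natural₂ ⟩
    m ∘ u ∘ (id #₁ inl) ∘ f                             ≈⟨ cancelˡ m-identityʳ ⟩
    (id #₁ inl) ∘ f                                     ∎

  square-inr : ∀ {A Y X} (f : Y ⇒ A # Y) (g : X ⇒ Y # X) →
               square f g ∘ inr ≈ m ∘ (((id #₁ inl) ∘ f) #₁ inr) ∘ g
  square-inr f g = pullʳ (pullʳ inject₂)

  square-coalgebra : ∀ {A Y X} {f : Y ⇒ A # Y} {g : X ⇒ Y # X} {k : Y ⇒ Φ A} {l : X ⇒ Φ A} →
                     out ∘ k ≈ (id #₁ k) ∘ f → out ∘ l ≈ m ∘ ((out ∘ k) #₁ l) ∘ g →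
                     out ∘ [ k , l ] ≈ (id #₁ [ k , l ]) ∘ square f g
  square-coalgebra {f = f} {g} {k} {l} out∘k out∘l = coproduct-ext
    (begin
      (out ∘ [ k , l ]) ∘ inl                    ≈⟨ pullʳ inject₁ ⟩
      out ∘ k                                    ≈⟨ ≈.trans out∘k (pushˡ id#k) ⟩
      (id #₁ [ k , l ]) ∘ (id #₁ inl) ∘ f        ≈⟨ ∘-resp-≈ʳ (square-inl f g) ⟨
      (id #₁ [ k , l ]) ∘ square f g ∘ inl       ≈⟨ sym-assoc ⟩
      ((id #₁ [ k , l ]) ∘ square f g) ∘ inl     ∎)
    (begin
      (out ∘ [ k , l ]) ∘ inr                    ≈⟨ pullʳ inject₂ ⟩
      out ∘ l                                    ≈⟨ out∘l ⟩
      m ∘ ((out ∘ k) #₁ l) ∘ g                   ≈⟨ ∘-resp-≈ʳ (∘-resp-≈ˡ (#-resp-≈ (≈.trans out∘k (pushˡ id#k)) (≈.sym inject₂))) ⟩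
      m ∘ (((id #₁ [ k , l ]) ∘ (id #₁ inl) ∘ f) #₁ ([ k , l ] ∘ inr)) ∘ g
                                                 ≈⟨ ∘-resp-≈ʳ (pushˡ #-homomorphism) ⟩
      m ∘ ((id #₁ [ k , l ]) #₁ [ k , l ]) ∘ (((id #₁ inl) ∘ f) #₁ inr) ∘ g
                                                 ≈⟨ extend m-morphism₂ ⟨
      (id #₁ [ k , l ]) ∘ m ∘ (((id #₁ inl) ∘ f) #₁ inr) ∘ g
                                                 ≈⟨ ∘-resp-≈ʳ (square-inr f g) ⟨
      (id #₁ [ k , l ]) ∘ square f g ∘ inr       ≈⟨ sym-assoc ⟩
      ((id #₁ [ k , l ]) ∘ square f g) ∘ inr     ∎)
    where
    id#k : id #₁ k ≈ (id #₁ [ k , l ]) ∘ (id #₁ inl)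
    id#k = ≈.trans (#-resp-≈ ≈.refl (≈.sym inject₁)) id#-homomorphism

  φalgOf-daggerOf : ∀ {A} {χ : Φ A ⇒ A} → φalgOf (daggerOf χ) ≈ χ
  φalgOf-daggerOf = elimʳ coit-out

  ΦAlgebraHom⇒ElgotHom : ∀ {A B} {χ : Φ A ⇒ A} {χ′ : Φ B ⇒ B} {f : A ⇒ B} →
                         IsΦAlgebraHom χ χ′ f → IsElgotHom (daggerOf χ) (daggerOf χ′) f
  ΦAlgebraHom⇒ElgotHom {χ = χ} {χ′} {f} hom e = begin
    χ′ ∘ coit ((f #₁ id) ∘ e)  ≈⟨ ∘-resp-≈ʳ (Φ₁-coit f e) ⟨
    χ′ ∘ Φ₁ f ∘ coit e         ≈⟨ pullˡ (≈.sym hom) ⟩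
    (f ∘ χ) ∘ coit e           ≈⟨ assoc ⟩
    f ∘ χ ∘ coit e             ∎

  module FromΦAlgebra {A : Obj} {χ : Φ A ⇒ A} (isΦAlgebra : IsΦAlgebra A χ) where
    χ∘η : χ ∘ η ≈ id
    χ∘η = proj₁ isΦAlgebra

    χ∘Φ₁χ : χ ∘ Φ₁ χ ≈ χ ∘ μ
    χ∘Φ₁χ = proj₂ isΦAlgebra

    χ∘out⁻¹-flatten : ∀ {Z} {h : Z ⇒ Φ A # Φ (Φ A)} →
                      χ ∘ out⁻¹ ∘ (χ #₁ Φ₁ χ) ∘ h ≈ χ ∘ out⁻¹ ∘ m ∘ (out #₁ μ) ∘ h
    χ∘out⁻¹-flatten {h = h} = begin
      χ ∘ out⁻¹ ∘ (χ #₁ Φ₁ χ) ∘ h       ≈⟨ ∘-resp-≈ʳ (extend (Φ₁-out⁻¹ χ)) ⟨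
      χ ∘ Φ₁ χ ∘ out⁻¹ ∘ h              ≈⟨ extend χ∘Φ₁χ ⟩
      χ ∘ μ ∘ out⁻¹ ∘ h                 ≈⟨ ∘-resp-≈ʳ (pullˡ μ-out⁻¹) ⟩
      χ ∘ (out⁻¹ ∘ m ∘ (out #₁ μ)) ∘ h  ≈⟨ ∘-resp-≈ʳ (pullʳ assoc) ⟩
      χ ∘ out⁻¹ ∘ m ∘ (out #₁ μ) ∘ h    ∎

    -- χ evaluates a tree by first evaluating its subtrees and then its root layer.
    χ∘out⁻¹ : χ ∘ out⁻¹ ≈ algOf χ ∘ (id #₁ χ)
    χ∘out⁻¹ = begin
      χ ∘ out⁻¹                                ≈⟨ ∘-resp-≈ʳ (elimʳ (≈.trans (∘-resp-≈ʳ out#μ∘η#η) m-identityˡ)) ⟨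
      χ ∘ out⁻¹ ∘ m ∘ (out #₁ μ) ∘ (η #₁ η)    ≈⟨ χ∘out⁻¹-flatten ⟨
      χ ∘ out⁻¹ ∘ (χ #₁ Φ₁ χ) ∘ (η #₁ η)       ≈⟨ ∘-resp-≈ʳ (∘-resp-≈ʳ id#η∘χ) ⟨
      χ ∘ out⁻¹ ∘ (id #₁ (η ∘ χ))              ≈⟨ pullʳ (pullʳ (≈.sym id#-homomorphism)) ⟨
      algOf χ ∘ (id #₁ χ)                      ∎
      where
      out#μ∘η#η : (out #₁ μ) ∘ (η #₁ η) ≈ u #₁ id
      out#μ∘η#η = ≈.trans (≈.sym #-homomorphism) (#-resp-≈ out∘η μ-η)
      id#η∘χ : id #₁ (η ∘ χ) ≈ (χ #₁ Φ₁ χ) ∘ (η #₁ η)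
      id#η∘χ = ≈.trans (#-resp-≈ (≈.sym χ∘η) (≈.sym (Φ₁-η χ))) #-homomorphism

    alg-unit : algOf χ ∘ u ≈ id
    alg-unit = ≈.trans (pullʳ (pullʳ (u-morphism η))) χ∘η

    alg-mult : algOf χ ∘ (algOf χ #₁ id) ≈ algOf χ ∘ m
    alg-mult = begin
      algOf χ ∘ (algOf χ #₁ id)                    ≈⟨ ∘-resp-≈ʳ (#-resp-≈ (≈.sym identityˡ) (≈.sym χ∘η)) ⟩
      algOf χ ∘ ((id ∘ χ ∘ ι) #₁ (χ ∘ η))          ≈⟨ ∘-resp-≈ʳ #-homomorphism ⟩
      algOf χ ∘ (id #₁ χ) ∘ ((χ ∘ ι) #₁ η)         ≈⟨ pullˡ (≈.sym χ∘out⁻¹) ⟩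
      (χ ∘ out⁻¹) ∘ ((χ ∘ ι) #₁ η)                 ≈⟨ pullʳ (∘-resp-≈ʳ χ∘ι#η) ⟩
      χ ∘ out⁻¹ ∘ (χ #₁ Φ₁ χ) ∘ (ι #₁ (η ∘ η))     ≈⟨ χ∘out⁻¹-flatten ⟩
      χ ∘ out⁻¹ ∘ m ∘ (out #₁ μ) ∘ (ι #₁ (η ∘ η))  ≈⟨ ∘-resp-≈ʳ (∘-resp-≈ʳ (∘-resp-≈ʳ out#μ∘ι#ηη)) ⟩
      χ ∘ out⁻¹ ∘ m ∘ ((id #₁ η) #₁ η)             ≈⟨ ∘-resp-≈ʳ (∘-resp-≈ʳ m-morphism₂) ⟨
      χ ∘ out⁻¹ ∘ (id #₁ η) ∘ m                    ≈⟨ pullʳ assoc ⟨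
      algOf χ ∘ m                                  ∎
      where
      ι : A # A ⇒ Φ A
      ι = out⁻¹ ∘ (id #₁ η)
      χ∘ι#η : (χ ∘ ι) #₁ η ≈ (χ #₁ Φ₁ χ) ∘ (ι #₁ (η ∘ η))
      χ∘ι#η = ≈.trans (#-resp-≈ ≈.refl (≈.sym (≈.trans (pullˡ (Φ₁-η χ)) (cancelʳ χ∘η))))
                      #-homomorphism
      out#μ∘ι#ηη : (out #₁ μ) ∘ (ι #₁ (η ∘ η)) ≈ (id #₁ η) #₁ η
      out#μ∘ι#ηη = ≈.trans (≈.sym #-homomorphism) (#-resp-≈ (cancelˡ out∘out⁻¹) (cancelˡ μ-η))

    solution : ∀ {X} (e : X ⇒ A # X) → daggerOf χ e ≈ algOf χ ∘ (id #₁ daggerOf χ e) ∘ e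
    solution e = begin
      χ ∘ coit e                                  ≈⟨ ∘-resp-≈ʳ (switch-outˡ (coit-commute e)) ⟩
      χ ∘ out⁻¹ ∘ (id #₁ coit e) ∘ e              ≈⟨ pullˡ χ∘out⁻¹ ⟩
      (algOf χ ∘ (id #₁ χ)) ∘ (id #₁ coit e) ∘ e  ≈⟨ pullʳ (pullˡ (≈.sym id#-homomorphism)) ⟩
      algOf χ ∘ (id #₁ (χ ∘ coit e)) ∘ e          ∎

    compositionality : ∀ {X Y} (f : Y ⇒ A # Y) (g : X ⇒ Y # X) →
                       daggerOf χ (square f g) ∘ inr ≈ daggerOf χ (bullet (daggerOf χ) f g)
    compositionality {X} f g = begin
      (χ ∘ coit (square f g)) ∘ inr              ≈⟨ pullʳ (∘-resp-≈ˡ (≈.sym coit-square)) ⟩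
      χ ∘ [ coit f , μ ∘ t ] ∘ inr               ≈⟨ ∘-resp-≈ʳ inject₂ ⟩
      χ ∘ μ ∘ t                                  ≈⟨ extend χ∘Φ₁χ ⟨
      χ ∘ Φ₁ χ ∘ t                               ≈⟨ ∘-resp-≈ʳ (Φ₁-coit χ _) ⟩
      χ ∘ coit ((χ #₁ id) ∘ (coit f #₁ id) ∘ g)  ≈⟨ ∘-resp-≈ʳ (coit-resp-≈ (pullˡ χ∘coit#id)) ⟩
      χ ∘ coit (((χ ∘ coit f) #₁ id) ∘ g)        ∎
      where
      t : X ⇒ Φ (Φ A)
      t = coit ((coit f #₁ id) ∘ g)
      coit-square : [ coit f , μ ∘ t ] ≈ coit (square f g)
      coit-square = coit-unique _ _ (square-coalgebra (coit-commute f) (out∘μ∘coit (coit f) g))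
      χ∘coit#id : (χ #₁ id) ∘ (coit f #₁ id) ≈ (χ ∘ coit f) #₁ id
      χ∘coit#id = ≈.trans (≈.sym #-homomorphism) (#-resp-≈ ≈.refl identityˡ)

    isCompleteElgot : IsCompleteElgot A (algOf χ) (daggerOf χ)
    isCompleteElgot = record
      { alg-unit = alg-unit
      ; alg-mult = alg-mult
      ; solution = solution
      ; functoriality = λ e f h f∘h → pullʳ (coit-fusion f∘h)
      ; compositionality = compositionality
      }

  module FromCompleteElgot {A : Obj} {a : A # A ⇒ A} {† : DaggerOp A}
                           (isElgot : IsCompleteElgot A a †) where
    open IsCompleteElgot isElgot

    †out∘η : † out ∘ η ≈ id
    †out∘η = begin
      † out ∘ η                       ≈⟨ ∘-resp-≈ˡ (solution out) ⟩
      (a ∘ (id #₁ † out) ∘ out) ∘ η   ≈⟨ pullʳ (pullʳ out∘η) ⟩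
      a ∘ (id #₁ † out) ∘ u           ≈⟨ ∘-resp-≈ʳ (u-morphism _) ⟩
      a ∘ u                           ≈⟨ alg-unit ⟩
      id                              ∎

    -- Compositionality for out ■ out, whose unfolding is [ id , μ ], turns Φ₁ († out) into μ.
    †out∘Φ₁†out : † out ∘ Φ₁ († out) ≈ † out ∘ μ
    †out∘Φ₁†out = begin
      † out ∘ Φ₁ († out)             ≈⟨ functoriality _ out (Φ₁ († out)) (Φ₁-coalgebra († out)) ⟩
      † (bullet † out out)           ≈⟨ compositionality out out ⟨
      † (square out out) ∘ inr       ≈⟨ ∘-resp-≈ˡ (functoriality _ out [ id , μ ] [id,μ]-coalgebra) ⟨
      († out ∘ [ id , μ ]) ∘ inr     ≈⟨ pullʳ inject₂ ⟩
      † out ∘ μ                      ∎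
      where
      [id,μ]-coalgebra : out ∘ [ id , μ ] ≈ (id #₁ [ id , μ ]) ∘ square out out
      [id,μ]-coalgebra = square-coalgebra (≈.trans identityʳ (≈.sym #-identityˡ)) (*-commute id)

    isΦAlgebra : IsΦAlgebra A (φalgOf †)
    isΦAlgebra = †out∘η , †out∘Φ₁†out

    algOf-φalgOf : algOf (φalgOf †) ≈ a
    algOf-φalgOf = begin
      † out ∘ out⁻¹ ∘ (id #₁ η)                       ≈⟨ ∘-resp-≈ˡ (solution out) ⟩
      (a ∘ (id #₁ † out) ∘ out) ∘ out⁻¹ ∘ (id #₁ η)   ≈⟨ pullʳ (pullʳ (cancelˡ out∘out⁻¹)) ⟩
      a ∘ (id #₁ † out) ∘ (id #₁ η)                   ≈⟨ ∘-resp-≈ʳ (≈.sym id#-homomorphism) ⟩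
      a ∘ (id #₁ († out ∘ η))                         ≈⟨ elimʳ (≈.trans (#-resp-≈ ≈.refl †out∘η) #-identity) ⟩
      a                                               ∎

    daggerOf-φalgOf : ∀ {X} (e : X ⇒ A # X) → daggerOf (φalgOf †) e ≈ † e
    daggerOf-φalgOf e = functoriality e out (coit e) (coit-commute e)

  ElgotHom⇒ΦAlgebraHom : ∀ {A B} {† : DaggerOp A} {b : B # B ⇒ B} {‡ : DaggerOp B} {f : A ⇒ B} →
                         IsCompleteElgot B b ‡ → IsElgotHom † ‡ f →
                         IsΦAlgebraHom (φalgOf †) (φalgOf ‡) f
  ElgotHom⇒ΦAlgebraHom {f = f} isElgot hom =
    ≈.trans (≈.sym (hom out)) (≈.sym (IsCompleteElgot.functoriality isElgot _ out (Φ₁ f) (Φ₁-coalgebra f)))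

theorem4p21 : ∀ {o ℓ e : Level} (C : Category o ℓ e) (cop : FiniteCoproducts C)
    (P : ParametrizedMonad C) (F : FinalCoalgebras P) (K : KleisliLifting F) →
    let open Category C
        open ParametrizedMonad P
        open FinalCoalgebras F
        open Notions C cop P F K
    in
    (∀ (A : Obj) (χ : Φ A ⇒ A) → IsΦAlgebra A χ →
        IsCompleteElgot A (algOf χ) (daggerOf χ))
    × (∀ (A : Obj) (a : A # A ⇒ A) († : DaggerOp A) → IsCompleteElgot A a † →
        IsΦAlgebra A (φalgOf †))
    × (∀ (A : Obj) (χ : Φ A ⇒ A) → IsΦAlgebra A χ → φalgOf (daggerOf χ) ≈ χ)
    × (∀ (A : Obj) (a : A # A ⇒ A) († : DaggerOp A) → IsCompleteElgot A a † →
        (algOf (φalgOf †) ≈ a)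
        × (∀ {X : Obj} (e : X ⇒ A # X) → daggerOf (φalgOf †) e ≈ † e))
    × (∀ (A B : Obj) (χ : Φ A ⇒ A) (χ′ : Φ B ⇒ B) →
        IsΦAlgebra A χ → IsΦAlgebra B χ′ → (f : A ⇒ B) →
        IsΦAlgebraHom χ χ′ f → IsElgotHom (daggerOf χ) (daggerOf χ′) f)
    × (∀ (A B : Obj) (a : A # A ⇒ A) († : DaggerOp A) (b : B # B ⇒ B) (‡ : DaggerOp B) →
        IsCompleteElgot A a † → IsCompleteElgot B b ‡ → (f : A ⇒ B) →
        IsElgotHom † ‡ f → IsΦAlgebraHom (φalgOf †) (φalgOf ‡) f)
theorem4p21 C cop P F K =
    (λ _ _ isΦAlgebra → FromΦAlgebra.isCompleteElgot isΦAlgebra)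
  , (λ _ _ _ isElgot → FromCompleteElgot.isΦAlgebra isElgot)
  , (λ _ _ _ → φalgOf-daggerOf)
  , (λ _ _ _ isElgot → FromCompleteElgot.algOf-φalgOf isElgot , FromCompleteElgot.daggerOf-φalgOf isElgot)
  , (λ _ _ _ _ _ _ _ → ΦAlgebraHom⇒ElgotHom)
  , (λ _ _ _ _ _ _ _ isElgotB _ → ElgotHom⇒ΦAlgebraHom isElgotB)
  where open Correspondence C cop P F K
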